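{- Let $n\ge3$, let $H$ be a finite abelian group of order $2n^2+1$ and let $T\subseteq H$ satisfy $|T|=2n$, $T=T^{(-1)}$ and $T^2=2H-T^{(2)}+(2n-2)e$ in $\mathbb{Z}[H]$. Write $TT^{(2)}=\sum_{i=0}^M iX_i$ in $\mathbb{Z}[H]$, where $X_i$ is the set of elements of $H$ whose coefficient in $TT^{(2)}$ equals $i$ and $M$ is the largest coefficient (so $X_0,\dots,X_M$ partition $H$), and let $2\beta=|T\cap T^{(2)}|$. Then (1) $\sum_{i=1}^M i|X_i|=4n^2$; (2) $\sum_{i=0}^M|X_i|=2n^2+1$; (3) $\sum_{i=1}^M|X_i|=4n-\beta+\sum_{i\ge3}\frac{(i-1)(i-2)}{2}|X_i|$.
   Context: $H$ is written multiplicatively with identity $e$. In the group ring $\mathbb{Z}[H]$ a subset $A$ is identified with $\sum_{g\in A}g$ (so $H$ is the sum of all elements), and $A^{(t)}=\sum a_g g^t$ for $A=\sum a_g g$; $T^{(2)}=\{t^2:t\in T\}$. -}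

module Defs where

open import Data.Nat as ℕ using (ℕ; zero; suc)
open import Data.Integer as ℤ using (ℤ; +_)
open import Data.Fin using (Fin; _≟_)
open import Data.Fin.Properties using (any?)
open import Data.Fin.Subset using (Subset)
open import Data.Fin.Subset.Properties using (_∈?_)
open import Data.Bool using (Bool; true; false; if_then_else_)
open import Data.Vec using (lookup; tabulate)
open import Data.List using (List; foldr; map)
open import Data.List.Base using (allFin; upTo)
open import Data.Product using (_×_)
open import Relation.Nullary.Decidable using (⌊_⌋; _×-dec_)
open import Relation.Binary.PropositionalEquality using (_≡_)
open import Algebra.Core using (Op₁; Op₂)
open import Algebra.Structures using (IsAbelianGroup)

-- A finite abelian group of order N, with carrier Fin N
-- (every finite abelian group of order N is isomorphic to one of this form).
record FinAbGroup (N : ℕ) : Set where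
  field
    _∙_ : Op₂ (Fin N)
    e   : Fin N
    _⁻¹ : Op₁ (Fin N)
    isAbelianGroup : IsAbelianGroup _≡_ _∙_ e _⁻¹

sumℤ : {A : Set} → List A → (A → ℤ) → ℤ
sumℤ xs f = foldr (λ x acc → f x ℤ.+ acc) (+ 0) xs

count : {N : ℕ} → (Fin N → Bool) → ℕ
count {N} p = foldr (λ x acc → (if p x then 1 else 0) ℕ.+ acc) 0 (allFin N)

-- Σ_{i=a}^{b} f i  (empty if b < a)
range : ℕ → ℕ → List ℕ
range a b = map (a ℕ.+_) (upTo (suc b ℕ.∸ a))

sumFromTo : ℕ → ℕ → (ℕ → ℤ) → ℤ
sumFromTo a b f = sumℤ (range a b) f

module GroupRing {N : ℕ} (G : FinAbGroup N) where
  open FinAbGroup G public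

  ZH : Set
  ZH = Fin N → ℤ

  -- a subset A viewed as Σ_{g∈A} g
  ⟦_⟧ : Subset N → ZH
  ⟦ A ⟧ g = if lookup A g then + 1 else + 0

  Hall : ZH
  Hall g = + 1

  δe : ZH
  δe g = if ⌊ g ≟ e ⌋ then + 1 else + 0

  infixl 7 _⋆_ _·_
  infixl 6 _⊕_ _⊖_

  _⊕_ : ZH → ZH → ZH
  (x ⊕ y) g = x g ℤ.+ y g

  _⊖_ : ZH → ZH → ZH
  (x ⊖ y) g = x g ℤ.- y g

  _·_ : ℤ → ZH → ZH
  (k · x) g = k ℤ.* x g

  _⋆_ : ZH → ZH → ZH
  (x ⋆ y) g = sumℤ (allFin N) (λ h → x h ℤ.* y ((h ⁻¹) ∙ g))

  image : (Fin N → Fin N) → Subset N → Subset N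
  image f A = tabulate (λ g → ⌊ any? (λ h → (h ∈? A) ×-dec (f h ≟ g)) ⌋)

  inv-set : Subset N → Subset N
  inv-set = image _⁻¹

  sq-set : Subset N → Subset N
  sq-set = image (λ t → t ∙ t)

  levelSize : ZH → ℕ → ℕ
  levelSize x i = count (λ g → ⌊ x g ℤ.≟ + i ⌋)

{-# OPTIONS --safe #-}
-- Let C = T T^(2) have coefficients c_g, so that |X_i| counts the g with c_g = i.
-- Since (i-1)(i-2)/2 = (i² - 3i + 2)/2, all three sums are determined by the moments
-- Σ_g c_g and Σ_g c_g². The first moment is |T| |T^(2)| = 4n², as squaring is injective
-- in a group of odd order. For the second, write a_X(u) = Σ_k X_k X_(ku) for the
-- autocorrelation of X; then Σ_g c_g² = Σ_u a_T(u) a_S(u) with S = T^(2). Because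
-- T = T^(-1), a_T is the coefficient function of T² = 2H - S + (2n-2)e, and squaring
-- gives a_S(a²) = a_T(a), so everything reduces to |T|, |S|, [e ∈ T] and |T ∩ S| = 2β.
module Submission where

open import Defs
open import Algebra.Bundles using (AbelianGroup)
import Algebra.Properties.AbelianGroup as AbelianGroupProperties
import Algebra.Properties.CommutativeSemigroup as CommutativeSemigroupProperties
import Algebra.Properties.Loop as LoopProperties
open import Data.Bool using (Bool; true; false; if_then_else_; _∧_)
open import Data.Empty using (⊥-elim)
open import Data.Fin using (Fin; zero; suc; toℕ; _≟_)
open import Data.Fin.Permutation using (permutation)
open import Data.Fin.Properties using (any?; toℕ-injective)
open import Data.Fin.Subset using (Subset; ∣_∣; _∩_; _∈_)
open import Data.Fin.Subset.Properties using (_∈?_)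
open import Data.Integer as ℤ using (ℤ; +_; -[1+_]; _+_; _*_; _-_)
import Data.Integer.Properties as ℤₚ
open import Data.Integer.Tactic.RingSolver using (solve-∀)
open import Data.List using (List; []; _∷_; foldr; applyUpTo)
open import Data.List.Base using (allFin; tabulate)
import Data.List.Properties as Listₚ
open import Data.Nat as ℕ using (ℕ; zero; suc; _≤_; _<_; _≥_)
open import Data.Nat.DivMod using (m*n/n≡m)
import Data.Nat.Properties as ℕₚ
import Data.Nat.Tactic.RingSolver as ℕ-Solver
open import Data.Product using (_×_; _,_; ∃; Σ; uncurry)
open import Data.Vec using ([]; _∷_; lookup)
import Data.Vec.Properties as Vecₚ
open import Function using (_∘_; id)
open import Function.Definitions using (Injective)
open import Level using (0ℓ)
open import Relation.Binary.Definitions using (tri<; tri≈; tri>)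
open import Relation.Binary.PropositionalEquality
open import Relation.Nullary using (¬_; Dec; yes; no; does; contradiction)
open import Relation.Nullary.Decidable using (⌊_⌋; _×-dec_; dec-true; dec-false)

open import Algebra.Properties.Semiring.Sum ℤₚ.+-*-semiring
  using (sum; sum-cong-≗; sum-replicate-zero; ∑-comm; ∑-permute; ∑-distrib-+;
         *-distribˡ-sum; *-distribʳ-sum)

open ≡-Reasoning

𝟙 : Bool → ℤ
𝟙 b = if b then + 1 else + 0

𝟙-idem : ∀ b → 𝟙 b * 𝟙 b ≡ 𝟙 b
𝟙-idem true  = refl
𝟙-idem false = refl

𝟙-∧ : ∀ a b → 𝟙 (a ∧ b) ≡ 𝟙 a * 𝟙 b
𝟙-∧ true  b = sym (ℤₚ.*-identityˡ (𝟙 b))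
𝟙-∧ false b = refl

𝟙*𝟙-nonneg : ∀ a b → + 0 ℤ.≤ 𝟙 a * 𝟙 b
𝟙*𝟙-nonneg true  true  = ℤ.+≤+ ℕ.z≤n
𝟙*𝟙-nonneg true  false = ℤ.+≤+ ℕ.z≤n
𝟙*𝟙-nonneg false _     = ℤ.+≤+ ℕ.z≤n

δ : ∀ {n} → Fin n → Fin n → ℤ
δ x y = 𝟙 (does (x ≟ y))

δ-refl : ∀ {n} (x : Fin n) → δ x x ≡ + 1
δ-refl x = cong 𝟙 (dec-true (x ≟ x) refl)

δ-≢ : ∀ {n} {x y : Fin n} → x ≢ y → δ x y ≡ + 0
δ-≢ {x = x} {y} x≢y = cong 𝟙 (dec-false (x ≟ y) x≢y)

δ-sym : ∀ {n} (x y : Fin n) → δ x y ≡ δ y x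
δ-sym x y with x ≟ y
... | yes refl = sym (δ-refl x)
... | no x≢y   = sym (δ-≢ (x≢y ∘ sym))

δ-injective : ∀ {n} {f : Fin n → Fin n} → Injective _≡_ _≡_ f →
              ∀ x y → δ (f x) (f y) ≡ δ x y
δ-injective {f = f} f-injective x y with x ≟ y
... | yes refl = δ-refl (f x)
... | no x≢y   = δ-≢ (x≢y ∘ f-injective)

sum-zero : ∀ {n} {f : Fin n → ℤ} → (∀ x → f x ≡ + 0) → sum f ≡ + 0
sum-zero {n} f≡0 = trans (sum-cong-≗ f≡0) (sum-replicate-zero n)

sum-one : ∀ {n} → sum {n} (λ _ → + 1) ≡ + n
sum-one {zero}  = refl
sum-one {suc n} = cong (_+_ (+ 1)) (sum-one {n})

sum-δ : ∀ {n} (a : Fin n) (F : Fin n → ℤ) → sum (λ x → δ a x * F x) ≡ F a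
sum-δ {suc n} zero F =
  trans (cong₂ _+_ (ℤₚ.*-identityˡ (F zero)) (sum-replicate-zero n)) (ℤₚ.+-identityʳ (F zero))
sum-δ {suc n} (suc a) F = trans (ℤₚ.+-identityˡ _) (sum-δ a (F ∘ suc))

sum-nonneg : ∀ {n} (f : Fin n → ℤ) → (∀ x → + 0 ℤ.≤ f x) → + 0 ℤ.≤ sum f
sum-nonneg {zero}  f _   = ℤ.+≤+ ℕ.z≤n
sum-nonneg {suc n} f f≥0 = ℤₚ.+-mono-≤ (f≥0 zero) (sum-nonneg (f ∘ suc) (f≥0 ∘ suc))

sum-*-sum : ∀ {n} (f g : Fin n → ℤ) → sum f * sum g ≡ sum (λ h → sum (λ k → f h * g k))
sum-*-sum f g = trans (*-distribʳ-sum (sum g) f) (sum-cong-≗ (λ h → *-distribˡ-sum (f h) g))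

sum-linear : ∀ {n} a b (f g : Fin n → ℤ) →
             sum (λ x → a * f x + b * g x) ≡ a * sum f + b * sum g
sum-linear a b f g = trans (∑-distrib-+ (λ x → a * f x) (λ x → b * g x))
                           (sym (cong₂ _+_ (*-distribˡ-sum a f) (*-distribˡ-sum b g)))

sum-reindex : ∀ {n} (σ σ⁻¹ : Fin n → Fin n) →
              (∀ x → σ (σ⁻¹ x) ≡ x) → (∀ x → σ⁻¹ (σ x) ≡ x) →
              (f : Fin n → ℤ) → sum f ≡ sum (f ∘ σ)
sum-reindex σ σ⁻¹ σσ⁻¹ σ⁻¹σ f = ∑-permute f (permutation σ σ⁻¹ σσ⁻¹ σ⁻¹σ)

sum-indicator : ∀ {n} (A : Subset n) → sum (𝟙 ∘ lookup A) ≡ + ∣ A ∣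
sum-indicator []          = refl
sum-indicator (true ∷ A)  = cong (_+_ (+ 1)) (sum-indicator A)
sum-indicator (false ∷ A) = trans (ℤₚ.+-identityˡ _) (sum-indicator A)

sum-indicator-∩ : ∀ {n} (A B : Subset n) →
                  sum (λ x → 𝟙 (lookup A x) * 𝟙 (lookup B x)) ≡ + ∣ A ∩ B ∣
sum-indicator-∩ A B = trans (sum-cong-≗ pointwise) (sum-indicator (A ∩ B))
  where
  pointwise : ∀ x → 𝟙 (lookup A x) * 𝟙 (lookup B x) ≡ 𝟙 (lookup (A ∩ B) x)
  pointwise x = trans (sym (𝟙-∧ (lookup A x) (lookup B x)))
                      (cong 𝟙 (sym (Vecₚ.lookup-zipWith _∧_ x A B)))

sumℤ-allFin : ∀ {n} (f : Fin n → ℤ) → sumℤ (allFin n) f ≡ sum f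
sumℤ-allFin = go id
  where
  go : ∀ {n} {A : Set} (h : Fin n → A) (f : A → ℤ) → sumℤ (tabulate h) f ≡ sum (f ∘ h)
  go {zero}  h f = refl
  go {suc n} h f = cong (_+_ (f (h zero))) (go (h ∘ suc) f)

count-as-sum : ∀ {n} (p : Fin n → Bool) → + count p ≡ sum (𝟙 ∘ p)
count-as-sum = go id
  where
  go : ∀ {n} {A : Set} (h : Fin n → A) (p : A → Bool) →
       + foldr (λ x acc → (if p x then 1 else 0) ℕ.+ acc) 0 (tabulate h) ≡ sum (𝟙 ∘ p ∘ h)
  go {zero}  h p = refl
  go {suc n} h p with p (h zero)
  ... | true  = cong (_+_ (+ 1)) (go (h ∘ suc) p)
  ... | false = trans (go (h ∘ suc) p) (sym (ℤₚ.+-identityˡ _))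

sumℤ-cong : ∀ {A : Set} (xs : List A) {f g : A → ℤ} → (∀ x → f x ≡ g x) →
            sumℤ xs f ≡ sumℤ xs g
sumℤ-cong []       _   = refl
sumℤ-cong (x ∷ xs) f≡g = cong₂ _+_ (f≡g x) (sumℤ-cong xs f≡g)

sumℤ-sum-comm : ∀ {A : Set} {n} (xs : List A) (F : A → Fin n → ℤ) →
                sumℤ xs (λ i → sum (F i)) ≡ sum (λ g → sumℤ xs (λ i → F i g))
sumℤ-sum-comm {n = n} []       F = sym (sum-replicate-zero n)
sumℤ-sum-comm         (x ∷ xs) F =
  trans (cong (_+_ (sum (F x))) (sumℤ-sum-comm xs F)) (sym (∑-distrib-+ (F x) _))

fixedPointFree-involution⇒even : ∀ {N} (σ : Fin N → Fin N) → (∀ x → σ (σ x) ≡ x) →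
                                  (∀ x → σ x ≢ x) → ∃ λ z → z + z ≡ + N
fixedPointFree-involution⇒even {N} σ σσ≡id σx≢x = sum before , orbits-counted-once
  where
  -- each orbit {x, σ x} contributes exactly one of its two points
  before : Fin N → ℤ
  before x = 𝟙 (does (toℕ x ℕ.<? toℕ (σ x)))

  σ-twice : ∀ x → toℕ (σ (σ x)) ≡ toℕ x
  σ-twice x = cong toℕ (σσ≡id x)

  before-pair : ∀ x → before x + before (σ x) ≡ + 1
  before-pair x with ℕₚ.<-cmp (toℕ x) (toℕ (σ x))
  ... | tri< x<σx _ σx≮x = cong₂ _+_
    (cong 𝟙 (dec-true (_ ℕ.<? _) x<σx))
    (cong 𝟙 (dec-false (_ ℕ.<? _) (σx≮x ∘ subst (toℕ (σ x) ℕ.<_) (σ-twice x))))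
  ... | tri≈ _ x≡σx _ = contradiction (sym (toℕ-injective x≡σx)) (σx≢x x)
  ... | tri> x≮σx _ σx<x = cong₂ _+_
    (cong 𝟙 (dec-false (_ ℕ.<? _) x≮σx))
    (cong 𝟙 (dec-true (_ ℕ.<? _) (subst (toℕ (σ x) ℕ.<_) (sym (σ-twice x)) σx<x)))

  orbits-counted-once : sum before + sum before ≡ + N
  orbits-counted-once = begin
    sum before + sum before
      ≡⟨ cong (_+_ (sum before)) (sum-reindex σ σ σσ≡id σσ≡id before) ⟩
    sum before + sum (before ∘ σ)
      ≡⟨ ∑-distrib-+ before (before ∘ σ) ⟨
    sum (λ x → before x + before (σ x))
      ≡⟨ sum-cong-≗ before-pair ⟩
    sum {N} (λ _ → + 1)
      ≡⟨ sum-one ⟩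
    + N ∎

module FiniteAbelianGroup {N : ℕ} (G : FinAbGroup N) where
  open FinAbGroup G

  abelianGroup : AbelianGroup 0ℓ 0ℓ
  abelianGroup = record { isAbelianGroup = isAbelianGroup }

  open AbelianGroup abelianGroup public using (assoc; comm; identityˡ; identityʳ; inverseʳ)
  open AbelianGroupProperties abelianGroup public
    using (⁻¹-involutive; ⁻¹-injective; ⁻¹-∙-comm; \\-leftDividesˡ; \\-leftDividesʳ;
           x∙y⁻¹≈ε⇒x≈y; loop)
  open LoopProperties loop using (identityˡ-unique)
  open CommutativeSemigroupProperties (AbelianGroup.commutativeSemigroup abelianGroup) public
    using (interchange)

  sum-translate : ∀ a (f : Fin N → ℤ) → sum f ≡ sum (λ x → f (a ∙ x))
  sum-translate a = sum-reindex (a ∙_) ((a ⁻¹) ∙_) (\\-leftDividesˡ a) (\\-leftDividesʳ a)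

  sum-invert : ∀ (f : Fin N → ℤ) → sum f ≡ sum (f ∘ _⁻¹)
  sum-invert = sum-reindex _⁻¹ _⁻¹ ⁻¹-involutive ⁻¹-involutive

  module _ (odd-order : ∀ z → z + z ≢ + N) where

    involution-trivial : ∀ a → a ∙ a ≡ e → a ≡ e
    involution-trivial a a²≡e with a ≟ e
    ... | yes a≡e = a≡e
    ... | no a≢e  = ⊥-elim (uncurry odd-order (fixedPointFree-involution⇒even
                      (a ∙_) a-twice (λ x → a≢e ∘ identityˡ-unique a x)))
      where
      a-twice : ∀ x → a ∙ (a ∙ x) ≡ x
      a-twice x = trans (sym (assoc a a x)) (trans (cong (_∙ x) a²≡e) (identityˡ x))

    square-injective : Injective _≡_ _≡_ (λ x → x ∙ x)
    square-injective {x} {y} x²≡y² =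
      x∙y⁻¹≈ε⇒x≈y x y (involution-trivial (x ∙ (y ⁻¹)) (begin
        (x ∙ (y ⁻¹)) ∙ (x ∙ (y ⁻¹))  ≡⟨ interchange x (y ⁻¹) x (y ⁻¹) ⟩
        (x ∙ x) ∙ ((y ⁻¹) ∙ (y ⁻¹))  ≡⟨ cong₂ _∙_ x²≡y² (⁻¹-∙-comm y y) ⟩
        (y ∙ y) ∙ ((y ∙ y) ⁻¹)       ≡⟨ inverseʳ (y ∙ y) ⟩
        e                            ∎))

module GroupRingProperties {N : ℕ} (G : FinAbGroup N) where
  open GroupRing G
  open FiniteAbelianGroup G

  T²-equation : ℕ → Subset N → Set
  T²-equation n T =
    ∀ g → (⟦ T ⟧ ⋆ ⟦ T ⟧) g ≡ ((+ 2 · Hall) ⊖ ⟦ sq-set T ⟧ ⊕ ((+ (2 ℕ.* n) - + 2) · δe)) g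

  δe≡δ : ∀ g → δe g ≡ δ e g
  δe≡δ g with g ≟ e
  ... | yes refl = sym (δ-refl g)
  ... | no g≢e   = sym (δ-≢ (g≢e ∘ sym))

  ⋆-as-sum : ∀ x y g → (x ⋆ y) g ≡ sum (λ h → x h * y ((h ⁻¹) ∙ g))
  ⋆-as-sum x y g = sumℤ-allFin (λ h → x h * y ((h ⁻¹) ∙ g))

  ⟦⟧⋆⟦⟧-nonneg : ∀ A B g → + 0 ℤ.≤ (⟦ A ⟧ ⋆ ⟦ B ⟧) g
  ⟦⟧⋆⟦⟧-nonneg A B g = subst (+ 0 ℤ.≤_) (sym (⋆-as-sum ⟦ A ⟧ ⟦ B ⟧ g))
    (sum-nonneg (λ h → ⟦ A ⟧ h * ⟦ B ⟧ ((h ⁻¹) ∙ g))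
                (λ h → 𝟙*𝟙-nonneg (lookup A h) (lookup B ((h ⁻¹) ∙ g))))

  sum-⋆ : ∀ x y → sum (x ⋆ y) ≡ sum x * sum y
  sum-⋆ x y = begin
    sum (x ⋆ y)
      ≡⟨ sum-cong-≗ (⋆-as-sum x y) ⟩
    sum (λ g → sum (λ h → x h * y ((h ⁻¹) ∙ g)))
      ≡⟨ ∑-comm (λ g h → x h * y ((h ⁻¹) ∙ g)) ⟩
    sum (λ h → sum (λ g → x h * y ((h ⁻¹) ∙ g)))
      ≡⟨ sum-cong-≗ (λ h → sum-translate (h ⁻¹) (λ k → x h * y k)) ⟨
    sum (λ h → sum (λ k → x h * y k))
      ≡⟨ sum-*-sum x y ⟨
    sum x * sum y ∎

  autocorrelation : ZH → ZH
  autocorrelation x u = sum (λ k → x k * x (k ∙ u))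

  autocorrelation-⟦⟧-e : ∀ A → autocorrelation ⟦ A ⟧ e ≡ sum ⟦ A ⟧
  autocorrelation-⟦⟧-e A = sum-cong-≗ λ k →
    trans (cong (λ g → ⟦ A ⟧ k * ⟦ A ⟧ g) (identityʳ k)) (𝟙-idem (lookup A k))

  sum-autocorrelation : ∀ x → sum (autocorrelation x) ≡ sum x * sum x
  sum-autocorrelation x = begin
    sum (λ u → sum (λ k → x k * x (k ∙ u)))
      ≡⟨ ∑-comm (λ u k → x k * x (k ∙ u)) ⟩
    sum (λ k → sum (λ u → x k * x (k ∙ u)))
      ≡⟨ sum-cong-≗ (λ k → sum-translate k (λ g → x k * x g)) ⟨
    sum (λ k → sum (λ g → x k * x g))
      ≡⟨ sum-*-sum x x ⟨
    sum x * sum x ∎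

  autocorrelation-symmetric : ∀ x → (∀ g → x (g ⁻¹) ≡ x g) →
                              ∀ u → autocorrelation x u ≡ (x ⋆ x) u
  autocorrelation-symmetric x x-symmetric u = begin
    sum (λ k → x k * x (k ∙ u))
      ≡⟨ sum-invert (λ k → x k * x (k ∙ u)) ⟩
    sum (λ h → x (h ⁻¹) * x ((h ⁻¹) ∙ u))
      ≡⟨ sum-cong-≗ (λ h → cong (_* x ((h ⁻¹) ∙ u)) (x-symmetric h)) ⟩
    sum (λ h → x h * x ((h ⁻¹) ∙ u))
      ≡⟨ ⋆-as-sum x x u ⟨
    (x ⋆ x) u ∎

  sum-product-of-translates : ∀ y h k →
    sum (λ g → y ((h ⁻¹) ∙ g) * y ((k ⁻¹) ∙ g)) ≡ autocorrelation y ((k ⁻¹) ∙ h)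
  sum-product-of-translates y h k = begin
    sum (λ g → y ((h ⁻¹) ∙ g) * y ((k ⁻¹) ∙ g))
      ≡⟨ sum-translate h (λ g → y ((h ⁻¹) ∙ g) * y ((k ⁻¹) ∙ g)) ⟩
    sum (λ x → y ((h ⁻¹) ∙ (h ∙ x)) * y ((k ⁻¹) ∙ (h ∙ x)))
      ≡⟨ sum-cong-≗ (λ x → cong₂ (λ a b → y a * y b) (\\-leftDividesʳ h x) (shift x)) ⟩
    sum (λ x → y x * y (x ∙ ((k ⁻¹) ∙ h))) ∎
    where
    shift : ∀ x → (k ⁻¹) ∙ (h ∙ x) ≡ x ∙ ((k ⁻¹) ∙ h)
    shift x = trans (sym (assoc (k ⁻¹) h x)) (comm ((k ⁻¹) ∙ h) x)

  sum-square-⋆-as-double-sum : ∀ x y →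
    sum (λ g → (x ⋆ y) g * (x ⋆ y) g)
    ≡ sum (λ h → sum (λ k → x h * x k * autocorrelation y ((k ⁻¹) ∙ h)))
  sum-square-⋆-as-double-sum x y = begin
    sum (λ g → (x ⋆ y) g * (x ⋆ y) g)
      ≡⟨ sum-cong-≗ (λ g → trans (cong₂ _*_ (⋆-as-sum x y g) (⋆-as-sum x y g))
                                 (sum-*-sum (term g) (term g))) ⟩
    sum (λ g → sum (λ h → sum (λ k → term g h * term g k)))
      ≡⟨ trans (∑-comm (λ g h → sum (λ k → term g h * term g k)))
               (sum-cong-≗ (λ h → ∑-comm (λ g k → term g h * term g k))) ⟩
    sum (λ h → sum (λ k → sum (λ g → term g h * term g k)))
      ≡⟨ sum-cong-≗ (λ h → sum-cong-≗ (λ k → factor h k)) ⟩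
    sum (λ h → sum (λ k → x h * x k * sum (λ g → y ((h ⁻¹) ∙ g) * y ((k ⁻¹) ∙ g))))
      ≡⟨ sum-cong-≗ (λ h → sum-cong-≗ (λ k →
           cong (x h * x k *_) (sum-product-of-translates y h k))) ⟩
    sum (λ h → sum (λ k → x h * x k * autocorrelation y ((k ⁻¹) ∙ h))) ∎
    where
    term : Fin N → Fin N → ℤ
    term g h = x h * y ((h ⁻¹) ∙ g)
    *-interchange : ∀ a b c d → a * b * (c * d) ≡ a * c * (b * d)
    *-interchange = solve-∀
    factor : ∀ h k → sum (λ g → term g h * term g k)
                     ≡ x h * x k * sum (λ g → y ((h ⁻¹) ∙ g) * y ((k ⁻¹) ∙ g))
    factor h k = trans
      (sum-cong-≗ (λ g → *-interchange (x h) (y ((h ⁻¹) ∙ g)) (x k) (y ((k ⁻¹) ∙ g))))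
      (sym (*-distribˡ-sum (x h * x k) (λ g → y ((h ⁻¹) ∙ g) * y ((k ⁻¹) ∙ g))))

  sum-weighted-by-quotient : ∀ x (F : ZH) →
    sum (λ h → sum (λ k → x h * x k * F ((k ⁻¹) ∙ h))) ≡ sum (λ u → autocorrelation x u * F u)
  sum-weighted-by-quotient x F = begin
    sum (λ h → sum (λ k → x h * x k * F ((k ⁻¹) ∙ h)))
      ≡⟨ ∑-comm (λ h k → x h * x k * F ((k ⁻¹) ∙ h)) ⟩
    sum (λ k → sum (λ h → x h * x k * F ((k ⁻¹) ∙ h)))
      ≡⟨ sum-cong-≗ (λ k → trans (sum-translate k (λ h → x h * x k * F ((k ⁻¹) ∙ h)))
                                 (sum-cong-≗ (reorder k))) ⟩
    sum (λ k → sum (λ u → x k * x (k ∙ u) * F u))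
      ≡⟨ ∑-comm (λ k u → x k * x (k ∙ u) * F u) ⟩
    sum (λ u → sum (λ k → x k * x (k ∙ u) * F u))
      ≡⟨ sum-cong-≗ (λ u → *-distribʳ-sum (F u) (λ k → x k * x (k ∙ u))) ⟨
    sum (λ u → autocorrelation x u * F u) ∎
    where
    reorder : ∀ k u → x (k ∙ u) * x k * F ((k ⁻¹) ∙ (k ∙ u)) ≡ x k * x (k ∙ u) * F u
    reorder k u = cong₂ _*_ (ℤₚ.*-comm (x (k ∙ u)) (x k)) (cong F (\\-leftDividesʳ k u))

  sum-square-⋆ : ∀ x y →
    sum (λ g → (x ⋆ y) g * (x ⋆ y) g) ≡ sum (λ u → autocorrelation x u * autocorrelation y u)
  sum-square-⋆ x y =
    trans (sum-square-⋆-as-double-sum x y) (sum-weighted-by-quotient x (autocorrelation y))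

  module _ {f : Fin N → Fin N} (f-injective : Injective _≡_ _≡_ f) (A : Subset N) where

    sum-δ-injective : ∀ (F : ZH) x → sum (λ z → F z * δ (f z) (f x)) ≡ F x
    sum-δ-injective F x = trans (sum-cong-≗ pointwise) (sum-δ x F)
      where
      pointwise : ∀ z → F z * δ (f z) (f x) ≡ δ x z * F z
      pointwise z = trans (cong (F z *_) (trans (δ-injective f-injective z x) (δ-sym z x)))
                          (ℤₚ.*-comm (F z) (δ x z))

    ⟦image⟧-as-sum : ∀ y → ⟦ image f A ⟧ y ≡ sum (λ x → ⟦ A ⟧ x * δ (f x) y)
    ⟦image⟧-as-sum y = trans (cong 𝟙 (Vecₚ.lookup∘tabulate _ y))
                             (by-preimage y (any? λ h → (h ∈? A) ×-dec (f h ≟ y)))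
      where
      by-preimage : ∀ y → (d : Dec (∃ λ h → h ∈ A × f h ≡ y)) →
                    𝟙 ⌊ d ⌋ ≡ sum (λ x → ⟦ A ⟧ x * δ (f x) y)
      by-preimage .(f h) (yes (h , h∈A , refl)) =
        sym (trans (sum-δ-injective ⟦ A ⟧ h) (cong 𝟙 (Vecₚ.[]=⇒lookup h∈A)))
      by-preimage y (no ∄h) = sym (sum-zero term-zero)
        where
        term-zero : ∀ x → 𝟙 (lookup A x) * δ (f x) y ≡ + 0
        term-zero x with lookup A x in x∈?A
        ... | false = refl
        ... | true  = cong (_*_ (+ 1))
                           (δ-≢ (λ fx≡y → ∄h (x , Vecₚ.lookup⇒[]= x A x∈?A , fx≡y)))

    ⟦image⟧-at-image : ∀ x → ⟦ image f A ⟧ (f x) ≡ ⟦ A ⟧ x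
    ⟦image⟧-at-image x = trans (⟦image⟧-as-sum (f x)) (sum-δ-injective ⟦ A ⟧ x)

    sum-over-image : ∀ (F : ZH) →
                     sum (λ y → ⟦ image f A ⟧ y * F y) ≡ sum (λ x → ⟦ A ⟧ x * F (f x))
    sum-over-image F = begin
      sum (λ y → ⟦ image f A ⟧ y * F y)
        ≡⟨ sum-cong-≗ (λ y → trans (cong (_* F y) (⟦image⟧-as-sum y))
                                   (*-distribʳ-sum (F y) (λ x → ⟦ A ⟧ x * δ (f x) y))) ⟩
      sum (λ y → sum (λ x → ⟦ A ⟧ x * δ (f x) y * F y))
        ≡⟨ ∑-comm (λ y x → ⟦ A ⟧ x * δ (f x) y * F y) ⟩
      sum (λ x → sum (λ y → ⟦ A ⟧ x * δ (f x) y * F y))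
        ≡⟨ sum-cong-≗ (λ x → trans (sum-cong-≗ (λ y → ℤₚ.*-assoc (⟦ A ⟧ x) (δ (f x) y) (F y)))
                                   (sym (*-distribˡ-sum (⟦ A ⟧ x) (λ y → δ (f x) y * F y)))) ⟩
      sum (λ x → ⟦ A ⟧ x * sum (λ y → δ (f x) y * F y))
        ≡⟨ sum-cong-≗ (λ x → cong (⟦ A ⟧ x *_) (sum-δ (f x) F)) ⟩
      sum (λ x → ⟦ A ⟧ x * F (f x)) ∎

    sum-image : sum ⟦ image f A ⟧ ≡ sum ⟦ A ⟧
    sum-image = begin
      sum ⟦ image f A ⟧
        ≡⟨ sum-cong-≗ (λ y → ℤₚ.*-identityʳ (⟦ image f A ⟧ y)) ⟨
      sum (λ y → ⟦ image f A ⟧ y * + 1)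
        ≡⟨ sum-over-image (λ _ → + 1) ⟩
      sum (λ x → ⟦ A ⟧ x * + 1)
        ≡⟨ sum-cong-≗ (λ x → ℤₚ.*-identityʳ (⟦ A ⟧ x)) ⟩
      sum ⟦ A ⟧ ∎

  autocorrelation-sq-set : Injective _≡_ _≡_ (λ x → x ∙ x) → ∀ A a →
                           autocorrelation ⟦ sq-set A ⟧ (a ∙ a) ≡ autocorrelation ⟦ A ⟧ a
  autocorrelation-sq-set square-injective A a = begin
    sum (λ x → ⟦ S ⟧ x * ⟦ S ⟧ (x ∙ (a ∙ a)))
      ≡⟨ sum-over-image square-injective A (λ x → ⟦ S ⟧ (x ∙ (a ∙ a))) ⟩
    sum (λ u → ⟦ A ⟧ u * ⟦ S ⟧ ((u ∙ u) ∙ (a ∙ a)))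
      ≡⟨ sum-cong-≗ (λ u → cong (⟦ A ⟧ u *_) (square-of-product u)) ⟩
    sum (λ u → ⟦ A ⟧ u * ⟦ A ⟧ (u ∙ a)) ∎
    where
    S : Subset N
    S = sq-set A
    square-of-product : ∀ u → ⟦ S ⟧ ((u ∙ u) ∙ (a ∙ a)) ≡ ⟦ A ⟧ (u ∙ a)
    square-of-product u =
      trans (cong ⟦ S ⟧ (interchange u u a a)) (⟦image⟧-at-image square-injective A (u ∙ a))

module SquareEquation (n : ℕ) (G : FinAbGroup (2 ℕ.* n ℕ.* n ℕ.+ 1))
  (T : Subset (2 ℕ.* n ℕ.* n ℕ.+ 1)) (∣T∣≡2n : ∣ T ∣ ≡ 2 ℕ.* n)
  (T≡T⁻¹ : T ≡ GroupRing.inv-set G T) (T²≡ : GroupRingProperties.T²-equation G n T)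
  where
  open GroupRing G
  open FiniteAbelianGroup G
  open GroupRingProperties G

  W : ℤ
  W = + (2 ℕ.* n)

  S : Subset (2 ℕ.* n ℕ.* n ℕ.+ 1)
  S = sq-set T

  E : ZH
  E = (+ 2 · Hall) ⊖ ⟦ S ⟧ ⊕ ((W - + 2) · δe)

  C : ZH
  C = ⟦ T ⟧ ⋆ ⟦ S ⟧

  odd-order : ∀ z → z + z ≢ + (2 ℕ.* n ℕ.* n ℕ.+ 1)
  odd-order (+ k)    k+k≡N = ℕₚ.even≢odd k (n ℕ.* n)
    (trans (cong (k ℕ.+_) (ℕₚ.+-identityʳ k)) (trans (ℤₚ.+-injective k+k≡N) (N-odd n)))
    where
    N-odd : ∀ n → 2 ℕ.* n ℕ.* n ℕ.+ 1 ≡ suc (2 ℕ.* (n ℕ.* n))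
    N-odd = ℕ-Solver.solve-∀
  odd-order -[1+ k ] ()

  square-inj : Injective _≡_ _≡_ (λ x → x ∙ x)
  square-inj = square-injective odd-order

  T-symmetric : ∀ g → ⟦ T ⟧ (g ⁻¹) ≡ ⟦ T ⟧ g
  T-symmetric g = trans (cong (λ A → ⟦ A ⟧ (g ⁻¹)) T≡T⁻¹) (⟦image⟧-at-image ⁻¹-injective T g)

  autocorrelation-T : ∀ u → autocorrelation ⟦ T ⟧ u ≡ E u
  autocorrelation-T u = trans (autocorrelation-symmetric ⟦ T ⟧ T-symmetric u) (T²≡ u)

  sum-T : sum ⟦ T ⟧ ≡ W
  sum-T = trans (sum-indicator T) (cong +_ ∣T∣≡2n)

  sum-S : sum ⟦ S ⟧ ≡ W
  sum-S = trans (sum-image square-inj T) sum-T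

  -- the coefficient of e in T² = T T^(-1) is |T|
  e∉S : ⟦ S ⟧ e ≡ + 0
  e∉S = begin
    ⟦ S ⟧ e                                           ≡⟨ solve-for-a (⟦ S ⟧ e) W ⟩
    W - ((+ 2 * + 1 - ⟦ S ⟧ e) + (W - + 2) * + 1)     ≡⟨ cong (W -_) W≡E-e ⟨
    W - W                                             ≡⟨ ℤₚ.+-inverseʳ W ⟩
    + 0                                               ∎
    where
    solve-for-a : ∀ a w → a ≡ w - ((+ 2 * + 1 - a) + (w - + 2) * + 1)
    solve-for-a = solve-∀
    W≡E-e : W ≡ (+ 2 * + 1 - ⟦ S ⟧ e) + (W - + 2) * + 1
    W≡E-e = begin
      W                          ≡⟨ sum-T ⟨
      sum ⟦ T ⟧                  ≡⟨ autocorrelation-⟦⟧-e T ⟨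
      autocorrelation ⟦ T ⟧ e    ≡⟨ autocorrelation-T e ⟩
      E e                        ≡⟨ cong (λ d → (+ 2 * + 1 - ⟦ S ⟧ e) + (W - + 2) * d)
                                         (trans (δe≡δ e) (δ-refl e)) ⟩
      (+ 2 * + 1 - ⟦ S ⟧ e) + (W - + 2) * + 1 ∎

  e∉T : ⟦ T ⟧ e ≡ + 0
  e∉T = trans (sym (⟦image⟧-at-image square-inj T e)) (trans (cong ⟦ S ⟧ (identityˡ e)) e∉S)

  sum-against-E : ∀ (F : ZH) →
    sum (λ y → F y * E y) + sum (λ y → F y * ⟦ S ⟧ y) ≡ + 2 * sum F + (W - + 2) * F e
  sum-against-E F = begin
    sum (λ y → F y * E y) + sum (λ y → F y * ⟦ S ⟧ y)
      ≡⟨ ∑-distrib-+ (λ y → F y * E y) (λ y → F y * ⟦ S ⟧ y) ⟨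
    sum (λ y → F y * E y + F y * ⟦ S ⟧ y)
      ≡⟨ sum-cong-≗ pointwise ⟩
    sum (λ y → + 2 * F y + (W - + 2) * (δ e y * F y))
      ≡⟨ sum-linear (+ 2) (W - + 2) F (λ y → δ e y * F y) ⟩
    + 2 * sum F + (W - + 2) * sum (λ y → δ e y * F y)
      ≡⟨ cong (λ z → + 2 * sum F + (W - + 2) * z) (sum-δ e F) ⟩
    + 2 * sum F + (W - + 2) * F e ∎
    where
    expand : ∀ f a d w →
      f * ((+ 2 * + 1 - a) + (w - + 2) * d) + f * a ≡ + 2 * f + (w - + 2) * (d * f)
    expand = solve-∀
    pointwise : ∀ y → F y * E y + F y * ⟦ S ⟧ y ≡ + 2 * F y + (W - + 2) * (δ e y * F y)
    pointwise y = trans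
      (cong (λ d → F y * ((+ 2 * + 1 - ⟦ S ⟧ y) + (W - + 2) * d) + F y * ⟦ S ⟧ y) (δe≡δ y))
      (expand (F y) (⟦ S ⟧ y) (δ e y) W)

  C-nonneg : ∀ g → + 0 ℤ.≤ C g
  C-nonneg = ⟦⟧⋆⟦⟧-nonneg T S

  sum-C : sum C ≡ W * W
  sum-C = trans (sum-⋆ ⟦ T ⟧ ⟦ S ⟧) (cong₂ _*_ sum-T sum-S)

  sum-C² : sum (λ g → C g * C g) + + 4 * W ≡ + 3 * (W * W) + + ∣ T ∩ S ∣
  sum-C² = eliminate (sum (λ g → C g * C g)) P (+ ∣ T ∩ S ∣)
                     (trans (cong (_+ P) sum-C²≡) against-E) P+∣T∩S∣
    where
    aS : ZH
    aS = autocorrelation ⟦ S ⟧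

    P : ℤ
    P = sum (λ y → aS y * ⟦ S ⟧ y)

    sum-C²≡ : sum (λ g → C g * C g) ≡ sum (λ u → aS u * E u)
    sum-C²≡ = trans (sum-square-⋆ ⟦ T ⟧ ⟦ S ⟧) (sum-cong-≗ λ u →
      trans (cong (_* aS u) (autocorrelation-T u)) (ℤₚ.*-comm (E u) (aS u)))

    against-E : sum (λ u → aS u * E u) + P ≡ + 2 * (W * W) + (W - + 2) * W
    against-E = trans (sum-against-E aS) (cong₂ (λ a b → + 2 * a + (W - + 2) * b)
      (trans (sum-autocorrelation ⟦ S ⟧) (cong₂ _*_ sum-S sum-S))
      (trans (autocorrelation-⟦⟧-e S) sum-S))

    P≡ : P ≡ sum (λ a → ⟦ T ⟧ a * E a)
    P≡ = begin
      P
        ≡⟨ sum-cong-≗ (λ y → ℤₚ.*-comm (aS y) (⟦ S ⟧ y)) ⟩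
      sum (λ y → ⟦ S ⟧ y * aS y)
        ≡⟨ sum-over-image square-inj T aS ⟩
      sum (λ a → ⟦ T ⟧ a * aS (a ∙ a))
        ≡⟨ sum-cong-≗ (λ a → cong (⟦ T ⟧ a *_)
             (trans (autocorrelation-sq-set square-inj T a) (autocorrelation-T a))) ⟩
      sum (λ a → ⟦ T ⟧ a * E a) ∎

    P+∣T∩S∣ : P + + ∣ T ∩ S ∣ ≡ + 2 * W
    P+∣T∩S∣ = begin
      P + + ∣ T ∩ S ∣
        ≡⟨ cong₂ _+_ P≡ (sym (sum-indicator-∩ T S)) ⟩
      sum (λ a → ⟦ T ⟧ a * E a) + sum (λ a → ⟦ T ⟧ a * ⟦ S ⟧ a)
        ≡⟨ sum-against-E ⟦ T ⟧ ⟩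
      + 2 * sum ⟦ T ⟧ + (W - + 2) * ⟦ T ⟧ e
        ≡⟨ cong₂ (λ a b → + 2 * a + (W - + 2) * b) sum-T e∉T ⟩
      + 2 * W + (W - + 2) * + 0
        ≡⟨ cong (_+_ (+ 2 * W)) (ℤₚ.*-zeroʳ (W - + 2)) ⟩
      + 2 * W + + 0
        ≡⟨ ℤₚ.+-identityʳ (+ 2 * W) ⟩
      + 2 * W ∎

    eliminate : ∀ a p c → a + p ≡ + 2 * (W * W) + (W - + 2) * W → p + c ≡ + 2 * W →
                a + + 4 * W ≡ + 3 * (W * W) + c
    eliminate a p c a+p≡ p+c≡ = begin
      a + + 4 * W
        ≡⟨ regroup a p c W ⟩
      (a + p) - (p + c) + c + + 4 * W
        ≡⟨ cong₂ (λ x y → x - y + c + + 4 * W) a+p≡ p+c≡ ⟩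
      (+ 2 * (W * W) + (W - + 2) * W) - + 2 * W + c + + 4 * W
        ≡⟨ simplify W c ⟩
      + 3 * (W * W) + c ∎
      where
      regroup : ∀ a p c w → a + + 4 * w ≡ (a + p) - (p + c) + c + + 4 * w
      regroup = solve-∀
      simplify : ∀ w c → (+ 2 * (w * w) + (w - + 2) * w) - + 2 * w + c + + 4 * w
                         ≡ + 3 * (w * w) + c
      simplify = solve-∀

restrict≥ : ℕ → (ℕ → ℕ) → ℕ → ℕ
restrict≥ a φ m = if a ℕ.≤ᵇ m then φ m else 0

restrict≥-≤ : ∀ {a m} φ → a ≤ m → restrict≥ a φ m ≡ φ m
restrict≥-≤ {a} {m} φ a≤m with a ℕ.≤ᵇ m | ℕₚ.≤⇒≤ᵇ a≤m
... | true | _ = refl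

restrict≥-≰ : ∀ {a m} φ → ¬ a ≤ m → restrict≥ a φ m ≡ 0
restrict≥-≰ {a} {m} φ a≰m with a ℕ.≤ᵇ m | ℕₚ.≤ᵇ⇒≤ a m
... | false | _    = refl
... | true  | a≤m = contradiction (a≤m _) a≰m

pointMass : (ℕ → ℕ) → ℕ → ℕ → ℤ
pointMass φ m i = + φ i * 𝟙 ⌊ + m ℤ.≟ + i ⌋

module _ (φ : ℕ → ℕ) {m : ℕ} where

  pointMass-≡ : pointMass φ m m ≡ + φ m
  pointMass-≡ with + m ℤ.≟ + m
  ... | yes _  = ℤₚ.*-identityʳ (+ φ m)
  ... | no m≢m = contradiction refl m≢m

  pointMass-≢ : ∀ {i} → m ≢ i → pointMass φ m i ≡ + 0
  pointMass-≢ {i} m≢i with + m ℤ.≟ + i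
  ... | yes m≡i = contradiction (ℤₚ.+-injective m≡i) m≢i
  ... | no _    = ℤₚ.*-zeroʳ (+ φ i)

  sum-pointMass-above : ∀ (f : ℕ → ℕ) k → (∀ j → m < f j) →
                        sumℤ (applyUpTo f k) (pointMass φ m) ≡ + 0
  sum-pointMass-above f zero    _   = refl
  sum-pointMass-above f (suc k) m<f =
    cong₂ _+_ (pointMass-≢ (ℕₚ.<⇒≢ (m<f 0))) (sum-pointMass-above (f ∘ suc) k (m<f ∘ suc))

  sum-pointMass-around : ∀ b (f : ℕ → ℕ) k → (∀ j → f j ≡ b ℕ.+ j) → b ≤ m → m < b ℕ.+ k →
                         sumℤ (applyUpTo f k) (pointMass φ m) ≡ + φ m
  sum-pointMass-around b f zero _ b≤m m<b+0 =
    contradiction (subst (m <_) (ℕₚ.+-identityʳ b) m<b+0) (ℕₚ.≤⇒≯ b≤m)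
  sum-pointMass-around b f (suc k) f≡b+ b≤m m<b+k with m ℕ.≟ b
  ... | yes refl = begin
    pointMass φ m (f 0) + sumℤ (applyUpTo (f ∘ suc) k) (pointMass φ m)
      ≡⟨ cong₂ _+_ (trans (cong (pointMass φ m) f0≡m) pointMass-≡)
                   (sum-pointMass-above (f ∘ suc) k m<f∘suc) ⟩
    + φ m + + 0
      ≡⟨ ℤₚ.+-identityʳ (+ φ m) ⟩
    + φ m ∎
    where
    f0≡m : f 0 ≡ m
    f0≡m = trans (f≡b+ 0) (ℕₚ.+-identityʳ m)
    m<f∘suc : ∀ j → m < f (suc j)
    m<f∘suc j = subst (m <_) (sym (f≡b+ (suc j))) (ℕₚ.m<m+n m ℕ.z<s)
  ... | no m≢b = trans
    (cong₂ _+_ (pointMass-≢ (λ m≡f0 → m≢b (trans m≡f0 (trans (f≡b+ 0) (ℕₚ.+-identityʳ b)))))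
               (sum-pointMass-around (suc b) (f ∘ suc) k
                  (λ j → trans (f≡b+ (suc j)) (ℕₚ.+-suc b j))
                  (ℕₚ.≤∧≢⇒< b≤m (m≢b ∘ sym)) (subst (m <_) (ℕₚ.+-suc b k) m<b+k)))
    (ℤₚ.+-identityˡ (+ φ m))

  sumFromTo-pointMass : ∀ a M → m ≤ M → sumFromTo a M (pointMass φ m) ≡ + restrict≥ a φ m
  sumFromTo-pointMass a M m≤M =
    trans (cong (λ xs → sumℤ xs (pointMass φ m)) (Listₚ.map-upTo (a ℕ.+_) length))
          (by-position (a ℕ.≤? m))
    where
    length : ℕ
    length = suc M ℕ.∸ a
    by-position : Dec (a ≤ m) →
                  sumℤ (applyUpTo (a ℕ.+_) length) (pointMass φ m) ≡ + restrict≥ a φ m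
    by-position (yes a≤m) = trans
      (sum-pointMass-around a (a ℕ.+_) length (λ _ → refl) a≤m
        (subst (m <_) (sym (ℕₚ.m+[n∸m]≡n (ℕₚ.≤-trans a≤m (ℕₚ.m≤n⇒m≤1+n m≤M)))) (ℕ.s≤s m≤M)))
      (cong +_ (sym (restrict≥-≤ φ a≤m)))
    by-position (no a≰m) = trans
      (sum-pointMass-above (a ℕ.+_) length (λ j → ℕₚ.<-≤-trans (ℕₚ.≰⇒> a≰m) (ℕₚ.m≤m+n a j)))
      (cong +_ (sym (restrict≥-≰ φ a≰m)))

pred-choose-2 : ℕ → ℕ
pred-choose-2 i = ((i ℕ.∸ 1) ℕ.* (i ℕ.∸ 2)) ℕ./ 2

triangular : ℕ → ℕ
triangular zero    = 0
triangular (suc j) = suc j ℕ.+ triangular j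

2*triangular : ∀ j → 2 ℕ.* triangular j ≡ suc j ℕ.* j
2*triangular zero    = refl
2*triangular (suc j) = begin
  2 ℕ.* (suc j ℕ.+ triangular j)      ≡⟨ ℕₚ.*-distribˡ-+ 2 (suc j) (triangular j) ⟩
  2 ℕ.* suc j ℕ.+ 2 ℕ.* triangular j  ≡⟨ cong (2 ℕ.* suc j ℕ.+_) (2*triangular j) ⟩
  2 ℕ.* suc j ℕ.+ suc j ℕ.* j         ≡⟨ expand j ⟩
  suc (suc j) ℕ.* suc j               ∎
  where
  expand : ∀ j → 2 ℕ.* suc j ℕ.+ suc j ℕ.* j ≡ suc (suc j) ℕ.* suc j
  expand = ℕ-Solver.solve-∀

pred-choose-2-triangular : ∀ j → pred-choose-2 (suc (suc j)) ≡ triangular j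
pred-choose-2-triangular j =
  trans (cong (ℕ._/ 2) (trans (sym (2*triangular j)) (ℕₚ.*-comm 2 (triangular j))))
        (m*n/n≡m (triangular j) 2)

pred-choose-2-moments : ∀ k →
  2 ℕ.* pred-choose-2 k ℕ.+ 3 ℕ.* k ≡ k ℕ.* k ℕ.+ 2 ℕ.* restrict≥ 1 (λ _ → 1) k
pred-choose-2-moments zero          = refl
pred-choose-2-moments (suc zero)    = refl
pred-choose-2-moments (suc (suc j)) = begin
  2 ℕ.* pred-choose-2 (2 ℕ.+ j) ℕ.+ 3 ℕ.* (2 ℕ.+ j)
    ≡⟨ cong (λ x → 2 ℕ.* x ℕ.+ 3 ℕ.* (2 ℕ.+ j)) (pred-choose-2-triangular j) ⟩
  2 ℕ.* triangular j ℕ.+ 3 ℕ.* (2 ℕ.+ j)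
    ≡⟨ cong (ℕ._+ 3 ℕ.* (2 ℕ.+ j)) (2*triangular j) ⟩
  suc j ℕ.* j ℕ.+ 3 ℕ.* (2 ℕ.+ j)
    ≡⟨ expand j ⟩
  (2 ℕ.+ j) ℕ.* (2 ℕ.+ j) ℕ.+ 2 ℕ.* 1 ∎
  where
  expand : ∀ j → suc j ℕ.* j ℕ.+ 3 ℕ.* (2 ℕ.+ j) ≡ (2 ℕ.+ j) ℕ.* (2 ℕ.+ j) ℕ.+ 2 ℕ.* 1
  expand = ℕ-Solver.solve-∀

module LevelSets {N : ℕ} (c : Fin N → ℤ) (m : Fin N → ℕ) (c≡m : ∀ g → c g ≡ + m g)
                 (M : ℕ) (m≤M : ∀ g → m g ≤ M) where

  X : ℕ → ℕ
  X i = count (λ g → ⌊ c g ℤ.≟ + i ⌋)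

  sumFromTo-levels : ∀ φ a →
    sumFromTo a M (λ i → + (φ i ℕ.* X i)) ≡ sum (λ g → + restrict≥ a φ (m g))
  sumFromTo-levels φ a = begin
    sumℤ (range a M) (λ i → + (φ i ℕ.* X i))
      ≡⟨ sumℤ-cong (range a M) level-as-sum ⟩
    sumℤ (range a M) (λ i → sum (λ g → term i (c g)))
      ≡⟨ sumℤ-sum-comm (range a M) (λ i g → term i (c g)) ⟩
    sum (λ g → sumℤ (range a M) (λ i → term i (c g)))
      ≡⟨ sum-cong-≗ (λ g → trans (sumℤ-cong (range a M) (λ i → cong (term i) (c≡m g)))
                                 (sumFromTo-pointMass φ a M (m≤M g))) ⟩
    sum (λ g → + restrict≥ a φ (m g)) ∎
    where
    term : ℕ → ℤ → ℤ
    term i z = + φ i * 𝟙 ⌊ z ℤ.≟ + i ⌋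
    level-as-sum : ∀ i → + (φ i ℕ.* X i) ≡ sum (λ g → term i (c g))
    level-as-sum i = trans (ℤₚ.pos-* (φ i) (X i))
      (trans (cong (_*_ (+ φ i)) (count-as-sum (λ g → ⌊ c g ℤ.≟ + i ⌋)))
             (*-distribˡ-sum (+ φ i) (λ g → 𝟙 ⌊ c g ℤ.≟ + i ⌋)))

  sumFromTo-levels-unweighted : ∀ a →
    sumFromTo a M (λ i → + X i) ≡ sum (λ g → + restrict≥ a (λ _ → 1) (m g))
  sumFromTo-levels-unweighted a =
    trans (sumℤ-cong (range a M) (λ i → cong +_ (sym (ℕₚ.*-identityˡ (X i)))))
          (sumFromTo-levels (λ _ → 1) a)

  first-moment : sumFromTo 1 M (λ i → + (i ℕ.* X i)) ≡ sum (λ g → + m g)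
  first-moment = trans (sumFromTo-levels id 1) (sum-cong-≗ (λ g → cong +_ (restrict≥-1-id (m g))))
    where
    restrict≥-1-id : ∀ k → restrict≥ 1 id k ≡ k
    restrict≥-1-id zero    = refl
    restrict≥-1-id (suc k) = refl

  total-count : sumFromTo 0 M (λ i → + X i) ≡ + N
  total-count = trans (sumFromTo-levels-unweighted 0) sum-one

  pred-choose-2-weighted :
    sumFromTo 3 M (λ i → + (pred-choose-2 i ℕ.* X i)) ≡ sum (λ g → + pred-choose-2 (m g))
  pred-choose-2-weighted =
    trans (sumFromTo-levels pred-choose-2 3) (sum-cong-≗ (λ g → cong +_ (restrict≥-3 (m g))))
    where
    restrict≥-3 : ∀ k → restrict≥ 3 pred-choose-2 k ≡ pred-choose-2 k
    restrict≥-3 0                   = refl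
    restrict≥-3 1                   = refl
    restrict≥-3 2                   = refl
    restrict≥-3 (suc (suc (suc k))) = refl

  second-moment-relation :
    + 2 * sumFromTo 3 M (λ i → + (pred-choose-2 i ℕ.* X i)) + + 3 * sum (λ g → + m g)
    ≡ sum (λ g → + m g * + m g) + + 2 * sumFromTo 1 M (λ i → + X i)
  second-moment-relation = begin
    + 2 * sumFromTo 3 M (λ i → + (pred-choose-2 i ℕ.* X i)) + + 3 * sum (λ g → + m g)
      ≡⟨ cong (λ z → + 2 * z + + 3 * sum (λ g → + m g)) pred-choose-2-weighted ⟩
    + 2 * sum (q ∘ m) + + 3 * sum (λ g → + m g)
      ≡⟨ sum-linear (+ 2) (+ 3) (q ∘ m) (λ g → + m g) ⟨
    sum (λ g → + 2 * q (m g) + + 3 * + m g)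
      ≡⟨ sum-cong-≗ (λ g → moments (m g)) ⟩
    sum (λ g → + m g * + m g + + 2 * r (m g))
      ≡⟨ trans (∑-distrib-+ (λ g → + m g * + m g) (λ g → + 2 * r (m g)))
               (cong (_+_ (sum (λ g → + m g * + m g))) (sym (*-distribˡ-sum (+ 2) (r ∘ m)))) ⟩
    sum (λ g → + m g * + m g) + + 2 * sum (r ∘ m)
      ≡⟨ cong (λ z → sum (λ g → + m g * + m g) + + 2 * z) (sumFromTo-levels-unweighted 1) ⟨
    sum (λ g → + m g * + m g) + + 2 * sumFromTo 1 M (λ i → + X i) ∎
    where
    q r : ℕ → ℤ
    q k = + pred-choose-2 k
    r k = + restrict≥ 1 (λ _ → 1) k
    moments : ∀ k → + 2 * q k + + 3 * + k ≡ + k * + k + + 2 * r k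
    moments k = begin
      + 2 * q k + + 3 * + k
        ≡⟨ cong₂ _+_ (ℤₚ.pos-* 2 (pred-choose-2 k)) (ℤₚ.pos-* 3 k) ⟨
      + (2 ℕ.* pred-choose-2 k ℕ.+ 3 ℕ.* k)
        ≡⟨ cong +_ (pred-choose-2-moments k) ⟩
      + (k ℕ.* k ℕ.+ 2 ℕ.* restrict≥ 1 (λ _ → 1) k)
        ≡⟨ cong₂ _+_ (ℤₚ.pos-* k k) (ℤₚ.pos-* 2 (restrict≥ 1 (λ _ → 1) k)) ⟩
      + k * + k + + 2 * r k ∎

nonzero-count-from-moments : ∀ n β {A B s₁ s₂ : ℤ} →
  s₁ ≡ + (2 ℕ.* n) * + (2 ℕ.* n) →
  s₂ + + 4 * + (2 ℕ.* n) ≡ + 3 * (+ (2 ℕ.* n) * + (2 ℕ.* n)) + + (2 ℕ.* β) →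
  + 2 * B + + 3 * s₁ ≡ s₂ + + 2 * A →
  A ≡ + (4 ℕ.* n) - + β + B
nonzero-count-from-moments n β {A} {B} {s₁} {s₂} s₁≡ s₂≡ relation =
  ℤₚ.*-cancelˡ-≡ (+ 2) A (+ (4 ℕ.* n) - + β + B) (begin
    + 2 * A
      ≡⟨ regroup A s₂ w ⟩
    (s₂ + + 2 * A) - (s₂ + + 4 * w) + + 4 * w
      ≡⟨ cong₂ (λ x y → x - y + + 4 * w)
               (trans (sym relation) (cong (λ s → + 2 * B + + 3 * s) s₁≡)) s₂≡ ⟩
    (+ 2 * B + + 3 * (w * w)) - (+ 3 * (w * w) + + (2 ℕ.* β)) + + 4 * w
      ≡⟨ cong₂ (λ w b → (+ 2 * B + + 3 * (w * w)) - (+ 3 * (w * w) + b) + + 4 * w)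
               (ℤₚ.pos-* 2 n) (ℤₚ.pos-* 2 β) ⟩
    (+ 2 * B + + 3 * (+ 2 * + n * (+ 2 * + n)))
      - (+ 3 * (+ 2 * + n * (+ 2 * + n)) + + 2 * + β) + + 4 * (+ 2 * + n)
      ≡⟨ simplify B (+ β) (+ n) ⟩
    + 2 * (+ 4 * + n - + β + B)
      ≡⟨ cong (λ z → + 2 * (z - + β + B)) (ℤₚ.pos-* 4 n) ⟨
    + 2 * (+ (4 ℕ.* n) - + β + B) ∎)
  where
  w : ℤ
  w = + (2 ℕ.* n)
  regroup : ∀ a s w → + 2 * a ≡ (s + + 2 * a) - (s + + 4 * w) + + 4 * w
  regroup = solve-∀
  simplify : ∀ b β ν →
    (+ 2 * b + + 3 * (+ 2 * ν * (+ 2 * ν)))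
      - (+ 3 * (+ 2 * ν * (+ 2 * ν)) + + 2 * β) + + 4 * (+ 2 * ν)
    ≡ + 2 * (+ 4 * ν - β + b)
  simplify = solve-∀

lemma6 : (n : ℕ) → n ≥ 3 →
    (G : FinAbGroup (2 ℕ.* n ℕ.* n ℕ.+ 1)) →
    let open GroupRing G in
    (T : Subset (2 ℕ.* n ℕ.* n ℕ.+ 1)) →
    ∣ T ∣ ≡ 2 ℕ.* n →
    T ≡ inv-set T →
    (∀ g → (⟦ T ⟧ ⋆ ⟦ T ⟧) g
           ≡ ((+ 2 · Hall) ⊖ ⟦ sq-set T ⟧ ⊕ ((+ (2 ℕ.* n) ℤ.- + 2) · δe)) g) →
    (M : ℕ) →
    (∀ g → (⟦ T ⟧ ⋆ ⟦ sq-set T ⟧) g ℤ.≤ + M) →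
    Σ (Fin (2 ℕ.* n ℕ.* n ℕ.+ 1)) (λ g → (⟦ T ⟧ ⋆ ⟦ sq-set T ⟧) g ≡ + M) →
    (β : ℕ) → 2 ℕ.* β ≡ ∣ T ∩ sq-set T ∣ →
    let X = levelSize (⟦ T ⟧ ⋆ ⟦ sq-set T ⟧) in
    (sumFromTo 1 M (λ i → + (i ℕ.* X i)) ≡ + (4 ℕ.* n ℕ.* n))
    × (sumFromTo 0 M (λ i → + X i) ≡ + (2 ℕ.* n ℕ.* n ℕ.+ 1))
    × (sumFromTo 1 M (λ i → + X i)
       ≡ + (4 ℕ.* n) ℤ.- + β
         ℤ.+ sumFromTo 3 M (λ i → + ((((i ℕ.∸ 1) ℕ.* (i ℕ.∸ 2)) ℕ./ 2) ℕ.* X i)))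
lemma6 n _ G T ∣T∣≡2n T≡T⁻¹ T²≡ M C≤M _ β 2β≡∣T∩S∣ =
  trans first-moment (trans sum-m W²≡4n²) ,
  total-count ,
  nonzero-count-from-moments n β {s₂ = sum (λ g → + m g * + m g)}
    sum-m sum-m² second-moment-relation
  where
  open SquareEquation n G T ∣T∣≡2n T≡T⁻¹ T²≡
  m : Fin (2 ℕ.* n ℕ.* n ℕ.+ 1) → ℕ
  m g = ℤ.∣ C g ∣
  C≡m : ∀ g → C g ≡ + m g
  C≡m g = sym (ℤₚ.0≤i⇒+∣i∣≡i (C-nonneg g))
  m≤M : ∀ g → m g ≤ M
  m≤M g = ℤₚ.drop‿+≤+ (subst (ℤ._≤ + M) (C≡m g) (C≤M g))
  open LevelSets C m C≡m M m≤M
  sum-m : sum (λ g → + m g) ≡ W * W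
  sum-m = trans (sum-cong-≗ (sym ∘ C≡m)) sum-C
  sum-m² : sum (λ g → + m g * + m g) + + 4 * W ≡ + 3 * (W * W) + + (2 ℕ.* β)
  sum-m² = trans (cong (_+ + 4 * W) (sum-cong-≗ (λ g → sym (cong₂ _*_ (C≡m g) (C≡m g)))))
                 (trans sum-C² (cong (λ k → + 3 * (W * W) + + k) (sym 2β≡∣T∩S∣)))
  W²≡4n² : W * W ≡ + (4 ℕ.* n ℕ.* n)
  W²≡4n² = trans (sym (ℤₚ.pos-* (2 ℕ.* n) (2 ℕ.* n))) (cong +_ (square-of-double n))
    where
    square-of-double : ∀ n → 2 ℕ.* n ℕ.* (2 ℕ.* n) ≡ 4 ℕ.* n ℕ.* n
    square-of-double = ℕ-Solver.solve-∀
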